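{- Let $G$ be a finite abelian group whose Sylow $2$-subgroup is $P=\langle a_1\rangle\times\dots\times\langle a_n\rangle$, where $a_i$ has order $2^{m_i}>1$ for $1\le i\le n$. Let $H$ be a subgroup of $G$. (a) If $H$ is a perfect code of $G$, then either $H\cap P$ is trivial or the projection of $H\cap P$ onto $\langle a_i\rangle$ (with respect to the given direct decomposition of $P$) equals $\langle a_i\rangle$ for at least one $i\in\{1,\dots,n\}$. (b) If $H$ is a total perfect code of $G$, then the projection of $H\cap P$ onto $\langle a_i\rangle$ equals $\langle a_i\rangle$ for at least one $i\in\{1,\dots,n\}$.
   Context: All groups and graphs are finite; $e$ denotes the identity. For a group $G$ and $S\subseteq G$ with $e\notin S$ and $S^{ -1}=S$, the Cayley graph $\mathrm{Cay}(G,S)$ has vertex set $G$, with $x,y$ adjacent iff $yx^{ -1}\in S$. A subset $C$ of the vertex set of a graph is a perfect code if every vertex is at distance at most one from exactly one vertex of $C$; it is a total perfect code if every vertex has exactly one neighbour in $C$. A subset $C\subseteq G$ is called a perfect code (resp. total perfect code) of $G$ if it is a perfect code (resp. total perfect code) in some Cayley graph $\mathrm{Cay}(G,S)$ of $G$. -}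

module Defs where

open import Level using (0ℓ)
open import Data.Nat using (ℕ; zero; suc; _+_; _*_; _^_; _<_)
open import Data.Nat.Divisibility using (_∣_)
open import Data.Fin using (Fin; toℕ)
open import Data.Product using (Σ; ∃; _×_; _,_)
open import Data.Sum using (_⊎_)
open import Relation.Nullary using (¬_)
open import Relation.Binary.PropositionalEquality using (_≡_)
open import Relation.Unary using (Pred)
open import Algebra.Structures using (IsAbelianGroup)

record FinAbGroup : Set where
  field
    N   : ℕ
    _∙_ : Fin N → Fin N → Fin N
    ε   : Fin N
    _⁻¹ : Fin N → Fin N
    isAbelianGroup : IsAbelianGroup (_≡_ {A = Fin N}) _∙_ ε _⁻¹

module _ (G : FinAbGroup) where
  open FinAbGroup G

  El : Set
  El = Fin N

  pow : El → ℕ → El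
  pow g zero    = ε
  pow g (suc k) = g ∙ pow g k

  prod : (n : ℕ) → (Fin n → El) → El
  prod zero    f = ε
  prod (suc n) f = f Fin.zero ∙ prod n (λ i → f (Fin.suc i))
    where import Data.Fin as Fin

  HasOrder : El → ℕ → Set
  HasOrder g k = (0 < k) × (pow g k ≡ ε) × (∀ j → 0 < j → j < k → ¬ (pow g j ≡ ε))

  record IsSubgroup (H : Pred El 0ℓ) : Set where
    field
      has-ε  : H ε
      ∙-closed : ∀ {x y} → H x → H y → H (x ∙ y)
      ⁻¹-closed : ∀ {x} → H x → H (x ⁻¹)

  record IsConnectionSet (S : Pred El 0ℓ) : Set where
    field
      no-ε : ¬ S ε
      inv-closed : ∀ {x} → S x → S (x ⁻¹)

  Adj : Pred El 0ℓ → El → El → Set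
  Adj S x y = S (y ∙ (x ⁻¹))

  IsPerfectCodeIn : Pred El 0ℓ → Pred El 0ℓ → Set
  IsPerfectCodeIn S C = ∀ v → Σ El λ c →
    (C c × (c ≡ v ⊎ Adj S v c)) ×
    (∀ c′ → C c′ → (c′ ≡ v ⊎ Adj S v c′) → c′ ≡ c)

  IsTotalPerfectCodeIn : Pred El 0ℓ → Pred El 0ℓ → Set
  IsTotalPerfectCodeIn S C = ∀ v → Σ El λ c →
    (C c × Adj S v c) × (∀ c′ → C c′ → Adj S v c′ → c′ ≡ c)

  IsPerfectCode : Pred El 0ℓ → Set₁
  IsPerfectCode C = Σ (Pred El 0ℓ) λ S → IsConnectionSet S × IsPerfectCodeIn S C

  IsTotalPerfectCode : Pred El 0ℓ → Set₁
  IsTotalPerfectCode C = Σ (Pred El 0ℓ) λ S → IsConnectionSet S × IsTotalPerfectCodeIn S C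

  Exps : (n : ℕ) → (Fin n → ℕ) → Set
  Exps n m = (i : Fin n) → Fin (2 ^ m i)

  φ : (n : ℕ) (m : Fin n → ℕ) (a : Fin n → El) → Exps n m → El
  φ n m a k = prod n (λ i → pow (a i) (toℕ (k i)))

  sumℕ : (n : ℕ) → (Fin n → ℕ) → ℕ
  sumℕ zero    f = 0
  sumℕ (suc n) f = f Fin.zero + sumℕ n (λ i → f (Fin.suc i))
    where import Data.Fin as Fin

  -- P = ⟨a_1⟩ × … × ⟨a_n⟩ is (internally) the Sylow 2-subgroup of G:
  --  * each a i has order 2^(m i) > 1;
  --  * the product is direct (the product map is injective), so
  --    |P| = 2^(Σ m i);
  --  * |G| = 2^(Σ m i) · q with q odd (so P is a Sylow 2-subgroup).
  record IsSylow2Decomposition (n : ℕ) (m : Fin n → ℕ) (a : Fin n → El) : Set where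
    field
      m-pos   : ∀ i → 0 < m i
      order   : ∀ i → HasOrder (a i) (2 ^ m i)
      direct  : ∀ k k′ → φ n m a k ≡ φ n m a k′ → k ≡ k′
      sylow   : Σ ℕ λ q → ¬ (2 ∣ q) × N ≡ 2 ^ sumℕ n m * q

  InP : (n : ℕ) (m : Fin n → ℕ) (a : Fin n → El) → El → Set
  InP n m a x = Σ (Exps n m) λ k → φ n m a k ≡ x

  TrivialMeetP : (n : ℕ) (m : Fin n → ℕ) (a : Fin n → El) → Pred El 0ℓ → Set
  TrivialMeetP n m a H = ∀ x → H x → InP n m a x → x ≡ ε

  -- the projection of H ∩ P onto ⟨a_i⟩ (the i-th coordinate
  -- a_i^(k_i) of x = ∏ a_j^(k_j)) is all of ⟨a_i⟩
  ProjFull : (n : ℕ) (m : Fin n → ℕ) (a : Fin n → El) → Pred El 0ℓ → Fin n → Set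
  ProjFull n m a H i = ∀ (j : Fin (2 ^ m i)) →
    Σ (Exps n m) λ k → H (φ n m a k) × k i ≡ j

-- A subgroup H that is a (total) perfect code has square roots: if y ∙ y ∈ H, then
-- y ∙ y = c ∙ c for the code element c next to y, because the reflection y ∙ y ∙ c ⁻¹
-- is another code element next to y. Every involution of G lies in P, for otherwise
-- P ∪ P z would be a subgroup of order 2 * |P| = 2 ^ (T + 1) dividing |G| = 2 ^ T * q, q odd.
-- Now let x ≠ ε lie in H ∩ P. If some element of H ∩ P has an odd exponent at i, its
-- powers realise every exponent at i, odd numbers being units modulo 2 ^ m i.
-- Otherwise every element of H ∩ P is a square in P, hence by the two facts above a
-- square in H ∩ P; iterating, x is a 2 ^ T-th power of an element of P, so x = ε.
-- For a total perfect code, the code neighbour of ε is such an x.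

module Submission where

open import Defs
open import Level using (Level; 0ℓ)
open import Data.Empty using (⊥)
open import Data.Unit using (tt)
open import Data.Nat using (ℕ; zero; suc; _+_; _*_; _^_; _≤_; _<_; z≤n; s≤s; pred; NonZero; _%_; _/_)
open import Data.Nat.Properties
  using (+-0-commutativeMonoid; +-identityʳ; +-suc; *-comm; ^-distribˡ-+-*; ^-*-assoc; m^n≢0; suc-pred;
         even≢odd; m≤n+m; ≤-trans; ≤-pred; ≤-reflexive; +-monoˡ-≤; <⇒≱)
open import Data.Nat.Divisibility
  using (_∣_; divides; _∣0; ∣-refl; ∣-trans; ∣m∣n⇒∣m+n; m∣m*n; n∣m*n; *-cancelˡ-∣)
open import Data.Nat.DivMod using (_mod_; m≡m%n+[m/n]*n; m%n<n; [m+kn]%n≡m%n; m<n⇒m%n≡m)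
open import Data.Nat.Tactic.RingSolver using (solve-∀)
open import Data.Fin using (Fin; zero; suc; toℕ; combine; remQuot)
open import Data.Fin.Properties
  using (_≟_; any?; suc-injective; toℕ-injective; toℕ-fromℕ<; toℕ<n; remQuot-combine; combine-remQuot)
open import Data.Fin.Permutation using (Permutation′; permutation; _⟨$⟩ʳ_)
open import Data.Product using (Σ; ∃; ∃₂; _×_; _,_; proj₁; proj₂)
open import Data.Sum using (_⊎_; inj₁; inj₂)
open import Data.Vec.Functional using (foldr)
open import Function using (_∘_)
open import Function.Definitions using (Injective)
open import Relation.Nullary using (¬_; Dec; yes; no; contradiction)
open import Relation.Nullary.Decidable using (map′; _⊎-dec_; _×-dec_; ¬?; decidable-stable)
open import Relation.Unary using (Pred; Decidable; _∩_; ∁)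
open import Relation.Unary.Properties using (U?; _∪?_; _∩?_; ∁?)
open import Relation.Binary.PropositionalEquality
open import Algebra.Bundles using (AbelianGroup; CommutativeMonoid)
import Algebra.Properties.Group as GroupProperties
import Algebra.Properties.AbelianGroup as AbelianGroupProperties
import Algebra.Properties.CommutativeSemigroup as CommutativeSemigroupProperties
open import Algebra.Properties.CommutativeMonoid.Sum +-0-commutativeMonoid
  using (sum; sum-cong-≗; ∑-distrib-+; ∑-permute)

module Counting where

  private
    variable
      a ℓ : Level
      A B : Set a
      M : ℕ
      P Q : Pred (Fin M) ℓ

  indicator : Dec A → ℕ
  indicator (yes _) = 1
  indicator (no _)  = 0

  count : Decidable P → ℕ
  count P? = sum (indicator ∘ P?)

  indicator-cong : (A → B) → (B → A) → (A? : Dec A) (B? : Dec B) → indicator A? ≡ indicator B?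
  indicator-cong _ _ (yes _) (yes _) = refl
  indicator-cong _ _ (no _)  (no _)  = refl
  indicator-cong f _ (yes a) (no ¬b) = contradiction (f a) ¬b
  indicator-cong _ g (no ¬a) (yes b) = contradiction (g b) ¬a

  count-cong : (∀ x → P x → Q x) → (∀ x → Q x → P x) →
               (P? : Decidable P) (Q? : Decidable Q) → count P? ≡ count Q?
  count-cong P⊆Q Q⊆P P? Q? = sum-cong-≗ λ x → indicator-cong (P⊆Q x) (Q⊆P x) (P? x) (Q? x)

  count-∪ : (∀ x → P x → Q x → ⊥) → (P? : Decidable P) (Q? : Decidable Q) →
            count (P? ∪? Q?) ≡ count P? + count Q?
  count-∪ {P = P} {Q = Q} disjoint P? Q? =
    trans (sum-cong-≗ λ x → indicator-∪ (disjoint x) (P? x) (Q? x))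
          (∑-distrib-+ (indicator ∘ P?) (indicator ∘ Q?))
    where
    indicator-∪ : ∀ {x} → (P x → Q x → ⊥) → (p : Dec (P x)) (q : Dec (Q x)) →
                  indicator (p ⊎-dec q) ≡ indicator p + indicator q
    indicator-∪ _ (yes _) (no _)  = refl
    indicator-∪ _ (no _)  (yes _) = refl
    indicator-∪ _ (no _)  (no _)  = refl
    indicator-∪ disj (yes p) (yes q) = contradiction q (disj p)

  count-permute : (π : Permutation′ M) (P? : Decidable P) → count (P? ∘ (π ⟨$⟩ʳ_)) ≡ count P?
  count-permute π P? = sym (∑-permute (indicator ∘ P?) π)

  count-none : ∀ {M} {P : Pred (Fin M) ℓ} (P? : Decidable P) → (∀ x → ¬ P x) → count P? ≡ 0
  count-none {M = zero}  P? ∄P = refl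
  count-none {M = suc M} P? ∄P with P? zero
  ... | yes P0 = contradiction P0 (∄P zero)
  ... | no  _  = count-none (P? ∘ suc) (∄P ∘ suc)

  count-all : ∀ {M} {P : Pred (Fin M) ℓ} (P? : Decidable P) → (∀ x → P x) → count P? ≡ M
  count-all {M = zero}  P? ∀P = refl
  count-all {M = suc M} P? ∀P with P? zero
  ... | yes _   = cong suc (count-all (P? ∘ suc) (∀P ∘ suc))
  ... | no ¬P0  = contradiction (∀P zero) ¬P0

  count-pos : (P? : Decidable P) → ∀ {x} → P x → 0 < count P?
  count-pos P? {zero} Px with P? zero
  ... | yes _   = s≤s z≤n
  ... | no ¬Px  = contradiction Px ¬Px
  count-pos P? {suc x} Px =
    ≤-trans (count-pos (P? ∘ suc) Px) (m≤n+m _ (indicator (P? zero)))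

  count-singleton : ∀ {M} (x : Fin M) → count (x ≟_) ≡ 1
  count-singleton {suc M} zero    = cong suc (count-none {M = M} (λ y → zero ≟ suc y) λ _ ())
  count-singleton {suc M} (suc x) =
    trans (count-cong (λ _ → suc-injective) (λ _ → cong suc) _ (x ≟_)) (count-singleton x)

  count-image : ∀ {k M} (f : Fin k → Fin M) → Injective _≡_ _≡_ f →
                count (λ y → any? λ j → f j ≟ y) ≡ k
  count-image {zero}  f _   = count-none (λ y → any? λ j → f j ≟ y) λ _ ()
  count-image {suc k} f inj = begin
    count (λ y → any? λ j → f j ≟ y)
      ≡⟨ count-cong split join _ ((f zero ≟_) ∪? (λ y → any? λ j → f (suc j) ≟ y)) ⟩
    count ((f zero ≟_) ∪? (λ y → any? λ j → f (suc j) ≟ y))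
      ≡⟨ count-∪ disjoint _ _ ⟩
    count (f zero ≟_) + count (λ y → any? λ j → f (suc j) ≟ y)
      ≡⟨ cong₂ _+_ (count-singleton (f zero)) (count-image (f ∘ suc) (suc-injective ∘ inj)) ⟩
    suc k ∎
    where
    open ≡-Reasoning
    split : ∀ y → (∃ λ j → f j ≡ y) → f zero ≡ y ⊎ (∃ λ j → f (suc j) ≡ y)
    split y (zero  , eq) = inj₁ eq
    split y (suc j , eq) = inj₂ (j , eq)
    join : ∀ y → f zero ≡ y ⊎ (∃ λ j → f (suc j) ≡ y) → ∃ λ j → f j ≡ y
    join y (inj₁ eq)      = zero , eq
    join y (inj₂ (j , eq)) = suc j , eq
    disjoint : ∀ y → f zero ≡ y → (∃ λ j → f (suc j) ≡ y) → ⊥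
    disjoint y refl (j , eq) with inj eq
    ... | ()

open Counting

product : ∀ {n} → (Fin n → ℕ) → ℕ
product = foldr _*_ 1

enum : ∀ {n} (s : Fin n → ℕ) → Fin (product s) → (i : Fin n) → Fin (s i)
enum {suc n} s j zero    = proj₁ (remQuot {s zero} (product (s ∘ suc)) j)
enum {suc n} s j (suc i) = enum (s ∘ suc) (proj₂ (remQuot {s zero} (product (s ∘ suc)) j)) i

index : ∀ {n} (s : Fin n → ℕ) → ((i : Fin n) → Fin (s i)) → Fin (product s)
index {zero}  s v = zero
index {suc n} s v = combine (v zero) (index (s ∘ suc) (v ∘ suc))

enum-index : ∀ {n} (s : Fin n → ℕ) v (i : Fin n) → enum s (index s v) i ≡ v i
enum-index {suc n} s v zero    = cong proj₁ (remQuot-combine {k = product (s ∘ suc)} (v zero) _)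
enum-index {suc n} s v (suc i) =
  trans (cong (λ p → enum (s ∘ suc) (proj₂ p) i) (remQuot-combine {k = product (s ∘ suc)} (v zero) _))
        (enum-index (s ∘ suc) (v ∘ suc) i)

index-enum : ∀ {n} (s : Fin n → ℕ) (j : Fin (product s)) → index s (enum s j) ≡ j
index-enum {zero}  s zero = refl
index-enum {suc n} s j    =
  trans (cong (combine (enum s j zero)) (index-enum (s ∘ suc) _))
        (combine-remQuot {s zero} (product (s ∘ suc)) j)

Even Odd : ℕ → Set
Even κ = ∃ λ h → κ ≡ 2 * h
Odd  κ = ∃ λ h → κ ≡ suc (2 * h)

parity : ∀ κ → Even κ ⊎ Odd κ
parity zero    = inj₁ (0 , refl)
parity (suc κ) with parity κ
... | inj₁ (h , refl) = inj₂ (h , refl)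
... | inj₂ (h , refl) = inj₁ (suc h , cong suc (sym (+-suc h (h + 0))))

odd? : Decidable Odd
odd? κ with parity κ
... | inj₂ odd        = yes odd
... | inj₁ (h , κ≡2h) = no λ (h′ , κ≡1+2h′) → even≢odd h h′ (trans (sym κ≡2h) κ≡1+2h′)

¬odd⇒even : ∀ {κ} → ¬ Odd κ → Even κ
¬odd⇒even {κ} ¬odd with parity κ
... | inj₁ even = even
... | inj₂ odd  = contradiction odd ¬odd

odd-^-2^ : ∀ h t → ∃ λ c → suc (2 * h) ^ (2 ^ t) ≡ suc (2 ^ suc t * c)
odd-^-2^ h zero    = h , base h
  where
  base : ∀ h → suc (2 * h) * 1 ≡ suc (2 * 1 * h)
  base = solve-∀
odd-^-2^ h (suc t) with odd-^-2^ h t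
... | c , eq = c + 2 ^ t * c * c , (begin
  suc (2 * h) ^ (2 * 2 ^ t)       ≡⟨ cong (suc (2 * h) ^_) (*-comm 2 (2 ^ t)) ⟩
  suc (2 * h) ^ (2 ^ t * 2)       ≡⟨ ^-*-assoc (suc (2 * h)) (2 ^ t) 2 ⟨
  (suc (2 * h) ^ (2 ^ t)) ^ 2     ≡⟨ cong (_^ 2) eq ⟩
  suc (2 * 2 ^ t * c) ^ 2         ≡⟨ square (2 ^ t) c ⟩
  suc (2 * (2 * 2 ^ t) * (c + 2 ^ t * c * c)) ∎)
  where
  open ≡-Reasoning
  square : ∀ x c → suc (2 * x * c) * (suc (2 * x * c) * 1) ≡ suc (2 * (2 * x) * (c + x * c * c))
  square = solve-∀

odd-unit-mod-2^ : ∀ {κ} → Odd κ → ∀ t → ∃₂ λ u c → κ * u ≡ suc (c * 2 ^ t)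
odd-unit-mod-2^ (h , refl) t with odd-^-2^ h t
... | c , eq = suc (2 * h) ^ pred (2 ^ t) , 2 * c , (begin
  suc (2 * h) ^ suc (pred (2 ^ t))   ≡⟨ cong (suc (2 * h) ^_) (suc-pred (2 ^ t) {{m^n≢0 2 t}}) ⟩
  suc (2 * h) ^ (2 ^ t)              ≡⟨ eq ⟩
  suc (2 * 2 ^ t * c)                ≡⟨ cong suc (regroup (2 ^ t) c) ⟩
  suc (2 * c * 2 ^ t)                ∎)
  where
  open ≡-Reasoning
  regroup : ∀ x c → 2 * x * c ≡ 2 * c * x
  regroup = solve-∀

module _ (G : FinAbGroup) where
  open FinAbGroup G using (N; isAbelianGroup)

  abelianGroup : AbelianGroup 0ℓ 0ℓ
  abelianGroup = record { isAbelianGroup = isAbelianGroup }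

  open AbelianGroup abelianGroup
    using (_∙_; ε; _⁻¹; group; commutativeMonoid; assoc; comm; identityˡ; identityʳ; inverseˡ; inverseʳ)
  open GroupProperties group
    using (\\-leftDividesʳ; //-rightDividesˡ; //-rightDividesʳ; ⁻¹-anti-homo-//; ε⁻¹≈ε)
  open AbelianGroupProperties abelianGroup using (⁻¹-∙-comm; xyx⁻¹≈y)
  open CommutativeSemigroupProperties (CommutativeMonoid.commutativeSemigroup commutativeMonoid)
    using (interchange)
  open ≡-Reasoning

  pow-+ : ∀ g r s → pow G g (r + s) ≡ pow G g r ∙ pow G g s
  pow-+ g zero    s = sym (identityˡ _)
  pow-+ g (suc r) s = trans (cong (g ∙_) (pow-+ g r s)) (sym (assoc _ _ _))

  pow-∙ : ∀ g h r → pow G (g ∙ h) r ≡ pow G g r ∙ pow G h r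
  pow-∙ g h zero    = sym (identityˡ ε)
  pow-∙ g h (suc r) = trans (cong ((g ∙ h) ∙_) (pow-∙ g h r)) (interchange g h _ _)

  pow-ε : ∀ r → pow G ε r ≡ ε
  pow-ε zero    = refl
  pow-ε (suc r) = trans (identityˡ _) (pow-ε r)

  pow-* : ∀ g r s → pow G g (r * s) ≡ pow G (pow G g r) s
  pow-* g zero    s = sym (pow-ε s)
  pow-* g (suc r) s = begin
    pow G g (s + r * s)                 ≡⟨ pow-+ g s (r * s) ⟩
    pow G g s ∙ pow G g (r * s)         ≡⟨ cong (pow G g s ∙_) (pow-* g r s) ⟩
    pow G g s ∙ pow G (pow G g r) s     ≡⟨ pow-∙ g (pow G g r) s ⟨
    pow G (g ∙ pow G g r) s             ∎

  prod-cong : ∀ n {f g : Fin n → El G} → (∀ i → f i ≡ g i) → prod G n f ≡ prod G n g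
  prod-cong zero    f≗g = refl
  prod-cong (suc n) f≗g = cong₂ _∙_ (f≗g zero) (prod-cong n (f≗g ∘ suc))

  prod-∙ : ∀ n (f g : Fin n → El G) → prod G n (λ i → f i ∙ g i) ≡ prod G n f ∙ prod G n g
  prod-∙ zero    f g = sym (identityˡ ε)
  prod-∙ (suc n) f g =
    trans (cong ((f zero ∙ g zero) ∙_) (prod-∙ n (f ∘ suc) (g ∘ suc))) (interchange _ _ _ _)

  prod-ε : ∀ n → prod G n (λ _ → ε) ≡ ε
  prod-ε zero    = refl
  prod-ε (suc n) = trans (identityˡ _) (prod-ε n)

  prod-pow : ∀ n (f : Fin n → El G) r → pow G (prod G n f) r ≡ prod G n (λ i → pow G (f i) r)
  prod-pow n f zero    = sym (prod-ε n)
  prod-pow n f (suc r) = trans (cong (prod G n f ∙_) (prod-pow n f r)) (sym (prod-∙ n f _))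

  pow-closed : ∀ {H} → IsSubgroup G H → ∀ {x} r → H x → H (pow G x r)
  pow-closed H-sub zero    Hx = IsSubgroup.has-ε H-sub
  pow-closed H-sub (suc r) Hx = IsSubgroup.∙-closed H-sub Hx (pow-closed H-sub r Hx)

  translation : El G → Permutation′ N
  translation g = permutation (_∙ g) (_∙ g ⁻¹) (//-rightDividesˡ g) (//-rightDividesʳ g)

  module Lagrange {K : Pred (El G) 0ℓ} (K-sub : IsSubgroup G K) (K? : Decidable K) where
    open IsSubgroup K-sub

    RespectsCosets : Pred (El G) 0ℓ → Set
    RespectsCosets X = ∀ {y y′} → X y → K (y′ ∙ y ⁻¹) → X y′

    Coset : El G → Pred (El G) 0ℓ
    Coset x y = K (y ∙ x ⁻¹)

    coset? : ∀ x → Decidable (Coset x)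
    coset? x y = K? (y ∙ x ⁻¹)

    count-coset : ∀ x → count (coset? x) ≡ count K?
    count-coset x = count-permute (translation (x ⁻¹)) K?

    coset-leaves : ∀ {X} x → RespectsCosets X → RespectsCosets (X ∩ ∁ (Coset x))
    coset-leaves {X} x X-resp (Xy , y∉xK) Ky′y⁻¹ =
      X-resp Xy Ky′y⁻¹ , λ y′∈xK → y∉xK (subst K (shift _ _) (∙-closed (⁻¹-closed Ky′y⁻¹) y′∈xK))
      where
      shift : ∀ y y′ → (y′ ∙ y ⁻¹) ⁻¹ ∙ (y′ ∙ x ⁻¹) ≡ y ∙ x ⁻¹
      shift y y′ = begin
        (y′ ∙ y ⁻¹) ⁻¹ ∙ (y′ ∙ x ⁻¹)
          ≡⟨ cong (_∙ (y′ ∙ x ⁻¹)) (⁻¹-anti-homo-// y′ y) ⟩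
        (y ∙ y′ ⁻¹) ∙ (y′ ∙ x ⁻¹)    ≡⟨ assoc y (y′ ⁻¹) (y′ ∙ x ⁻¹) ⟩
        y ∙ (y′ ⁻¹ ∙ (y′ ∙ x ⁻¹))    ≡⟨ cong (y ∙_) (\\-leftDividesʳ y′ (x ⁻¹)) ⟩
        y ∙ x ⁻¹                     ∎

    count-remove-coset : ∀ {X} (X? : Decidable X) → RespectsCosets X → ∀ {x} → X x →
                         count X? ≡ count K? + count (X? ∩? ∁? (coset? x))
    count-remove-coset {X} X? X-resp {x} Xx = begin
      count X?                          ≡⟨ count-cong split join X? (coset? x ∪? rest?) ⟩
      count (coset? x ∪? rest?)         ≡⟨ count-∪ (λ _ y∈xK (_ , y∉xK) → y∉xK y∈xK) (coset? x) rest? ⟩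
      count (coset? x) + count rest?    ≡⟨ cong (_+ count rest?) (count-coset x) ⟩
      count K? + count rest?            ∎
      where
      rest? = X? ∩? ∁? (coset? x)
      split : ∀ y → X y → Coset x y ⊎ (X ∩ ∁ (Coset x)) y
      split y Xy with coset? x y
      ... | yes y∈xK = inj₁ y∈xK
      ... | no  y∉xK = inj₂ (Xy , y∉xK)
      join : ∀ y → Coset x y ⊎ (X ∩ ∁ (Coset x)) y → X y
      join y (inj₁ y∈xK)     = X-resp Xx y∈xK
      join y (inj₂ (Xy , _)) = Xy

    coset-union-count-divisible : ∀ fuel {X} (X? : Decidable X) → RespectsCosets X → count X? ≤ fuel →
                    count K? ∣ count X?
    coset-union-count-divisible fuel X? X-resp bound with any? X?
    ... | no ∄X = subst (count K? ∣_) (sym (count-none X? λ y Xy → ∄X (y , Xy))) (count K? ∣0)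
    coset-union-count-divisible zero       X? X-resp bound | yes (x , Xx) =
      contradiction bound (<⇒≱ (count-pos X? Xx))
    coset-union-count-divisible (suc fuel) X? X-resp bound | yes (x , Xx) =
      subst (count K? ∣_) (sym decomposition)
        (∣m∣n⇒∣m+n ∣-refl (coset-union-count-divisible fuel _ (coset-leaves x X-resp) smaller))
      where
      decomposition = count-remove-coset X? X-resp Xx
      smaller = ≤-pred (≤-trans (+-monoˡ-≤ _ (count-pos K? has-ε))
                                (subst (_≤ suc fuel) decomposition bound))

    lagrange : count K? ∣ N
    lagrange = subst (count K? ∣_) count-U
                 (coset-union-count-divisible N U? (λ _ _ → tt) (≤-reflexive count-U))
      where
      count-U : count (U? {A = El G}) ≡ N
      count-U = count-all U? (λ _ → tt)

  adjoin-square-root : ∀ {P z} → IsSubgroup G P → P (z ∙ z) → IsSubgroup G (λ y → P y ⊎ P (y ∙ z))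
  adjoin-square-root {P} {z} P-sub Pzz = record
    { has-ε     = inj₁ has-ε
    ; ∙-closed  = closed
    ; ⁻¹-closed = inverse-closed
    }
    where
    open IsSubgroup P-sub
    swap-last : ∀ u z v → u ∙ z ∙ v ≡ u ∙ v ∙ z
    swap-last u z v = trans (assoc u z v) (trans (cong (u ∙_) (comm z v)) (sym (assoc u v z)))
    closed : ∀ {u v} → P u ⊎ P (u ∙ z) → P v ⊎ P (v ∙ z) → P (u ∙ v) ⊎ P (u ∙ v ∙ z)
    closed         (inj₁ Pu)  (inj₁ Pv)  = inj₁ (∙-closed Pu Pv)
    closed {u} {v} (inj₂ Puz) (inj₁ Pv)  = inj₂ (subst P (swap-last u z v) (∙-closed Puz Pv))
    closed {u} {v} (inj₁ Pu)  (inj₂ Pvz) = inj₂ (subst P (sym (assoc u v z)) (∙-closed Pu Pvz))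
    closed {u} {v} (inj₂ Puz) (inj₂ Pvz) =
      inj₁ (subst P cancel-squares (∙-closed (∙-closed Puz Pvz) (⁻¹-closed Pzz)))
      where
      cancel-squares : (u ∙ z) ∙ (v ∙ z) ∙ (z ∙ z) ⁻¹ ≡ u ∙ v
      cancel-squares =
        trans (cong (_∙ (z ∙ z) ⁻¹) (interchange u z v z)) (//-rightDividesʳ (z ∙ z) (u ∙ v))
    inverse-closed : ∀ {u} → P u ⊎ P (u ∙ z) → P (u ⁻¹) ⊎ P (u ⁻¹ ∙ z)
    inverse-closed (inj₁ Pu)  = inj₁ (⁻¹-closed Pu)
    inverse-closed {u} (inj₂ Puz) = inj₂ (subst P invert (∙-closed (⁻¹-closed Puz) Pzz))
      where
      invert : (u ∙ z) ⁻¹ ∙ (z ∙ z) ≡ u ⁻¹ ∙ z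
      invert = begin
        (u ∙ z) ⁻¹ ∙ (z ∙ z)       ≡⟨ cong (_∙ (z ∙ z)) (⁻¹-∙-comm u z) ⟨
        u ⁻¹ ∙ z ⁻¹ ∙ (z ∙ z)      ≡⟨ assoc (u ⁻¹) (z ⁻¹) (z ∙ z) ⟩
        u ⁻¹ ∙ (z ⁻¹ ∙ (z ∙ z))    ≡⟨ cong (u ⁻¹ ∙_) (\\-leftDividesʳ z z) ⟩
        u ⁻¹ ∙ z                   ∎

  HasRootsOfSquares : Pred (El G) 0ℓ → Set
  HasRootsOfSquares H = ∀ y → H (y ∙ y) → Σ (El G) λ c → H c × c ∙ c ≡ y ∙ y

  module _ {H S : Pred (El G) 0ℓ} (H-sub : IsSubgroup G H) (S-conn : IsConnectionSet G S) where
    open IsSubgroup H-sub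
    open IsConnectionSet S-conn

    -- The reflection y ∙ y ∙ c ⁻¹ of c in y is again an H-neighbour of y.
    unique-neighbour-root : ∀ {y c} → H (y ∙ y) → H c → Adj G S y c →
                            (∀ c′ → H c′ → Adj G S y c′ → c′ ≡ c) → c ∙ c ≡ y ∙ y
    unique-neighbour-root {y} {c} Hyy Hc y~c unique =
      trans (cong (_∙ c) (sym reflection≡c)) (//-rightDividesˡ c (y ∙ y))
      where
      reflection-adjacent : (y ∙ y ∙ c ⁻¹) ∙ y ⁻¹ ≡ (c ∙ y ⁻¹) ⁻¹
      reflection-adjacent = begin
        (y ∙ y ∙ c ⁻¹) ∙ y ⁻¹    ≡⟨ cong (_∙ y ⁻¹) (assoc y y (c ⁻¹)) ⟩
        y ∙ (y ∙ c ⁻¹) ∙ y ⁻¹    ≡⟨ xyx⁻¹≈y y (y ∙ c ⁻¹) ⟩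
        y ∙ c ⁻¹                 ≡⟨ ⁻¹-anti-homo-// c y ⟨
        (c ∙ y ⁻¹) ⁻¹            ∎
      reflection≡c : y ∙ y ∙ c ⁻¹ ≡ c
      reflection≡c = unique _ (∙-closed Hyy (⁻¹-closed Hc))
                       (subst S (sym reflection-adjacent) (inv-closed y~c))

    perfectCode-roots : IsPerfectCodeIn G S H → HasRootsOfSquares H
    perfectCode-roots code y Hyy with code y
    ... | c , (Hc , inj₁ refl) , _      = c , Hc , refl
    ... | c , (Hc , inj₂ y~c)  , unique =
      c , Hc , unique-neighbour-root Hyy Hc y~c λ c′ Hc′ y~c′ → unique c′ Hc′ (inj₂ y~c′)

    totalPerfectCode-roots : IsTotalPerfectCodeIn G S H → HasRootsOfSquares H
    totalPerfectCode-roots code y Hyy with code y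
    ... | c , (Hc , y~c) , unique = c , Hc , unique-neighbour-root Hyy Hc y~c unique

    perfectCode-decidable : IsPerfectCodeIn G S H → Decidable H
    perfectCode-decidable code x with code x
    ... | c , (Hc , _) , unique with c ≟ x
    ...   | yes refl = yes Hc
    ...   | no  c≢x  = no λ Hx → c≢x (sym (unique x Hx (inj₁ refl)))

    -- H and S are closed under inverses, so h ⁻¹ is also a code neighbour of ε.
    totalPerfectCode-involution : IsTotalPerfectCodeIn G S H →
                                  Σ (El G) λ h → H h × h ∙ h ≡ ε × h ≢ ε
    totalPerfectCode-involution code with code ε
    ... | h , (Hh , ε~h) , unique = h , Hh , h∙h≡ε , λ h≡ε → no-ε (subst S h≡ε Sh)
      where
      ∙ε⁻¹ : ∀ x → x ∙ ε ⁻¹ ≡ x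
      ∙ε⁻¹ x = trans (cong (x ∙_) ε⁻¹≈ε) (identityʳ x)
      Sh : S h
      Sh = subst S (∙ε⁻¹ h) ε~h
      h⁻¹≡h : h ⁻¹ ≡ h
      h⁻¹≡h = unique (h ⁻¹) (⁻¹-closed Hh) (subst S (sym (∙ε⁻¹ (h ⁻¹))) (inv-closed Sh))
      h∙h≡ε : h ∙ h ≡ ε
      h∙h≡ε = trans (cong (h ∙_) (sym h⁻¹≡h)) (inverseʳ h)

  pow-multiple : ∀ {g M e} → pow G g M ≡ ε → M ∣ e → pow G g e ≡ ε
  pow-multiple {g} {M} g^M≡ε (divides q refl) =
    begin
      pow G g (q * M)            ≡⟨ cong (pow G g) (*-comm q M) ⟩
      pow G g (M * q)            ≡⟨ pow-* g M q ⟩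
      pow G (pow G g M) q        ≡⟨ cong (λ h → pow G h q) g^M≡ε ⟩
      pow G ε q                  ≡⟨ pow-ε q ⟩
      ε                          ∎

  pow-mod : ∀ {g M} .{{_ : NonZero M}} → pow G g M ≡ ε → ∀ r → pow G g (r % M) ≡ pow G g r
  pow-mod {g} {M} g^M≡ε r = sym (begin
    pow G g r                                   ≡⟨ cong (pow G g) (m≡m%n+[m/n]*n r M) ⟩
    pow G g (r % M + r / M * M)                 ≡⟨ pow-+ g (r % M) (r / M * M) ⟩
    pow G g (r % M) ∙ pow G g (r / M * M)
                                                ≡⟨ cong (pow G g (r % M) ∙_) (pow-multiple g^M≡ε (n∣m*n (r / M))) ⟩
    pow G g (r % M) ∙ ε                         ≡⟨ identityʳ _ ⟩
    pow G g (r % M)                             ∎)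

product-2^ : ∀ (G : FinAbGroup) n (m : Fin n → ℕ) → product (λ i → 2 ^ m i) ≡ 2 ^ sumℕ G n m
product-2^ G zero    m = refl
product-2^ G (suc n) m = trans (cong (2 ^ m zero *_) (product-2^ G n (m ∘ suc)))
                               (sym (^-distribˡ-+-* 2 (m zero) (sumℕ G n (m ∘ suc))))

2^-∣-2^sum : ∀ (G : FinAbGroup) n (m : Fin n → ℕ) i → 2 ^ m i ∣ 2 ^ sumℕ G n m
2^-∣-2^sum G (suc n) m i rewrite ^-distribˡ-+-* 2 (m zero) (sumℕ G n (m ∘ suc)) with i
... | zero  = m∣m*n _
... | suc i = ∣-trans (2^-∣-2^sum G n (m ∘ suc) i) (n∣m*n (2 ^ m zero))

module _ (G : FinAbGroup) {n : ℕ} {m : Fin n → ℕ} {a : Fin n → El G}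
         (D : IsSylow2Decomposition G n m a) where
  open AbelianGroup (abelianGroup G) using (_∙_; ε; _⁻¹; group; commutativeSemigroup; identityʳ; inverseʳ)
  open GroupProperties group using (inverseʳ-unique; \\-leftDividesʳ; //-rightDividesˡ)
  open AbelianGroupProperties (abelianGroup G) using (⁻¹-∙-comm)
  open CommutativeSemigroupProperties commutativeSemigroup using (interchange)
  open IsSylow2Decomposition D
  open ≡-Reasoning

  a-order : ∀ i → pow G (a i) (2 ^ m i) ≡ ε
  a-order i = proj₁ (proj₂ (order i))

  T : ℕ
  T = sumℕ G n m

  P : Pred (El G) 0ℓ
  P = InP G n m a

  a^_ : (Fin n → ℕ) → El G
  a^ r = prod G n (λ i → pow G (a i) (r i))

  a^-+ : ∀ r s → a^ (λ i → r i + s i) ≡ a^ r ∙ a^ s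
  a^-+ r s = trans (prod-cong G n λ i → pow-+ G (a i) (r i) (s i)) (prod-∙ G n _ _)

  a^-* : ∀ r t → a^ (λ i → r i * t) ≡ pow G (a^ r) t
  a^-* r t = trans (prod-cong G n λ i → pow-* G (a i) (r i) t) (sym (prod-pow G n _ t))

  reduce : (Fin n → ℕ) → Exps G n m
  reduce r i = _mod_ (r i) (2 ^ m i) {{m^n≢0 2 (m i)}}

  φ-reduce : ∀ r → φ G n m a (reduce r) ≡ a^ r
  φ-reduce r = prod-cong G n λ i →
    trans (cong (pow G (a i)) (toℕ-fromℕ< (m%n<n (r i) (2 ^ m i) {{m^n≢0 2 (m i)}})))
          (pow-mod G {{m^n≢0 2 (m i)}} (a-order i) (r i))

  a^∈P : ∀ r → P (a^ r)
  a^∈P r = reduce r , φ-reduce r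

  P-kill : ∀ {x} → P x → pow G x (2 ^ T) ≡ ε
  P-kill (k , refl) = begin
    pow G (a^ (toℕ ∘ k)) (2 ^ T)              ≡⟨ a^-* (toℕ ∘ k) (2 ^ T) ⟨
    a^ (λ i → toℕ (k i) * 2 ^ T)              ≡⟨ prod-cong G n (λ i → pow-multiple G (a-order i)
                                                   (∣-trans (2^-∣-2^sum G n m i) (n∣m*n (toℕ (k i))))) ⟩
    prod G n (λ _ → ε)                        ≡⟨ prod-ε G n ⟩
    ε                                         ∎

  P-subgroup : IsSubgroup G P
  P-subgroup = record
    { has-ε     = subst P (prod-ε G n) (a^∈P λ _ → 0)
    ; ∙-closed  = product-closed
    ; ⁻¹-closed = λ Px → subst P (sym (inverse-is-power Px)) (power-closed (pred (2 ^ T)) Px)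
    }
    where
    product-closed : ∀ {x y} → P x → P y → P (x ∙ y)
    product-closed (k , refl) (l , refl) =
      subst P (a^-+ (toℕ ∘ k) (toℕ ∘ l)) (a^∈P λ i → toℕ (k i) + toℕ (l i))
    power-closed : ∀ {x} t → P x → P (pow G x t)
    power-closed t (k , refl) = subst P (a^-* (toℕ ∘ k) t) (a^∈P λ i → toℕ (k i) * t)
    inverse-is-power : ∀ {x} → P x → x ⁻¹ ≡ pow G x (pred (2 ^ T))
    inverse-is-power {x} Px = sym (inverseʳ-unique x _
      (trans (cong (pow G x) (suc-pred (2 ^ T) {{m^n≢0 2 T}})) (P-kill Px)))

  private
    2^m : Fin n → ℕ
    2^m i = 2 ^ m i

    exps : Fin (product 2^m) → El G
    exps j = φ G n m a (enum 2^m j)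

    exps-injective : ∀ {j j′} → exps j ≡ exps j′ → j ≡ j′
    exps-injective {j} {j′} eq = begin
      j                          ≡⟨ index-enum 2^m j ⟨
      index 2^m (enum 2^m j)     ≡⟨ cong (index 2^m) (direct (enum 2^m j) (enum 2^m j′) eq) ⟩
      index 2^m (enum 2^m j′)    ≡⟨ index-enum 2^m j′ ⟩
      j′                         ∎

    P⇒image : ∀ {x} → P x → ∃ λ j → exps j ≡ x
    P⇒image (k , refl) = index 2^m k , prod-cong G n λ i → cong (pow G (a i) ∘ toℕ) (enum-index 2^m k i)

    image⇒P : ∀ {x} → (∃ λ j → exps j ≡ x) → P x
    image⇒P (j , refl) = enum 2^m j , refl

  P? : Decidable P
  P? x = map′ image⇒P P⇒image (any? λ j → exps j ≟ x)

  count-P : count P? ≡ 2 ^ T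
  count-P = begin
    count P?                               ≡⟨ count-cong (λ _ → P⇒image) (λ _ → image⇒P) P? _ ⟩
    count (λ x → any? λ j → exps j ≟ x)    ≡⟨ count-image exps exps-injective ⟩
    product 2^m                            ≡⟨ product-2^ G n m ⟩
    2 ^ T                                  ∎

  involution∈P : ∀ {z} → z ∙ z ≡ ε → P z
  involution∈P {z} z∙z≡ε with P? z | sylow
  ... | yes Pz  | _ = Pz
  ... | no  z∉P | q , 2∤q , N≡2^T*q =
    contradiction (*-cancelˡ-∣ (2 ^ T) {{m^n≢0 2 T}} 2^T*2∣2^T*q) 2∤q
    where
    open IsSubgroup P-subgroup
    K? : Decidable (λ y → P y ⊎ P (y ∙ z))
    K? = P? ∪? (P? ∘ (_∙ z))
    disjoint : ∀ y → P y → P (y ∙ z) → ⊥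
    disjoint y Py Pyz = z∉P (subst P (\\-leftDividesʳ y z) (∙-closed (⁻¹-closed Py) Pyz))
    count-K : count K? ≡ 2 ^ T * 2
    count-K = begin
      count K?                              ≡⟨ count-∪ disjoint P? (P? ∘ (_∙ z)) ⟩
      count P? + count (P? ∘ (_∙ z))        ≡⟨ cong (count P? +_) (count-permute (translation G z) P?) ⟩
      count P? + count P?                   ≡⟨ cong (λ c → c + c) count-P ⟩
      2 ^ T + 2 ^ T                         ≡⟨ cong (2 ^ T +_) (+-identityʳ (2 ^ T)) ⟨
      2 * 2 ^ T                             ≡⟨ *-comm 2 (2 ^ T) ⟩
      2 ^ T * 2                             ∎
    2^T*2∣2^T*q : 2 ^ T * 2 ∣ 2 ^ T * q
    2^T*2∣2^T*q = subst₂ _∣_ count-K N≡2^T*q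
      (Lagrange.lagrange G (adjoin-square-root G P-subgroup (subst P (sym z∙z≡ε) has-ε)) K?)

  -- If κ * u ≡ 1 modulo 2 ^ m i, the (j * u)-th power of φ k has i-th exponent j.
  odd-coordinate-projFull : ∀ {H} → IsSubgroup G H → ∀ k i → H (φ G n m a k) →
                            Odd (toℕ (k i)) → ProjFull G n m a H i
  odd-coordinate-projFull {H} H-sub k i Hk κ-odd j with odd-unit-mod-2^ κ-odd (m i)
  ... | u , c , κu≡1+cM = reduce e , He , toℕ-injective coordinate
    where
    M = 2 ^ m i
    κ = toℕ (k i)
    instance
      M≢0 : NonZero M
      M≢0 = m^n≢0 2 (m i)
    r = toℕ j * u
    e : Fin n → ℕ
    e l = toℕ (k l) * r
    He : H (φ G n m a (reduce e))
    He = subst H (sym (trans (φ-reduce e) (a^-* (toℕ ∘ k) r))) (pow-closed G H-sub r Hk)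
    coordinate : toℕ (reduce e i) ≡ toℕ j
    coordinate = begin
      toℕ (reduce e i)                  ≡⟨ toℕ-fromℕ< (m%n<n (κ * r) M) ⟩
      κ * (toℕ j * u) % M               ≡⟨ cong (_% M) (swap κ (toℕ j) u) ⟩
      toℕ j * (κ * u) % M               ≡⟨ cong (λ v → toℕ j * v % M) κu≡1+cM ⟩
      toℕ j * suc (c * M) % M           ≡⟨ cong (_% M) (expand (toℕ j) c M) ⟩
      (toℕ j + toℕ j * c * M) % M       ≡⟨ [m+kn]%n≡m%n (toℕ j) (toℕ j * c) M ⟩
      toℕ j % M                         ≡⟨ m<n⇒m%n≡m (toℕ<n j) ⟩
      toℕ j                             ∎
      where
      swap : ∀ κ t u → κ * (t * u) ≡ t * (κ * u)
      swap = solve-∀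
      expand : ∀ t c M → t * suc (c * M) ≡ t + t * c * M
      expand = solve-∀

  even-exponents-square : ∀ k → (∀ i → Even (toℕ (k i))) →
                          Σ (El G) λ y → P y × y ∙ y ≡ φ G n m a k
  even-exponents-square k even = a^ half , a^∈P half , trans (sym (a^-+ half half)) (prod-cong G n doubling)
    where
    half : Fin n → ℕ
    half i = proj₁ (even i)
    doubling : ∀ i → pow G (a i) (half i + half i) ≡ pow G (a i) (toℕ (k i))
    doubling i = cong (pow G (a i)) (sym (trans (proj₂ (even i)) (cong (half i +_) (+-identityʳ (half i)))))

  module _ {H : Pred (El G) 0ℓ} (H-sub : IsSubgroup G H) (roots : HasRootsOfSquares G H) where

    halve : ∀ {k} → H (φ G n m a k) → (∀ i → Even (toℕ (k i))) →
            Σ (El G) λ c → H c × P c × c ∙ c ≡ φ G n m a k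
    halve {k} Hk even with even-exponents-square k even
    ... | y , Py , y∙y≡x with roots y (subst H (sym y∙y≡x) Hk)
    ...   | c , Hc , c∙c≡y∙y = c , Hc , Pc , trans c∙c≡y∙y y∙y≡x
      where
      open IsSubgroup P-subgroup
      c∙y⁻¹-involution : c ∙ y ⁻¹ ∙ (c ∙ y ⁻¹) ≡ ε
      c∙y⁻¹-involution = begin
        c ∙ y ⁻¹ ∙ (c ∙ y ⁻¹)    ≡⟨ interchange c (y ⁻¹) c (y ⁻¹) ⟩
        c ∙ c ∙ (y ⁻¹ ∙ y ⁻¹)    ≡⟨ cong₂ _∙_ c∙c≡y∙y (⁻¹-∙-comm y y) ⟩
        y ∙ y ∙ (y ∙ y) ⁻¹       ≡⟨ inverseʳ (y ∙ y) ⟩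
        ε                        ∎
      Pc : P c
      Pc = subst P (//-rightDividesˡ y c) (∙-closed (involution∈P c∙y⁻¹-involution) Py)

    descend : ∀ t {x} → H x → P x →
              Σ (Fin n) (ProjFull G n m a H) ⊎ Σ (El G) λ c → H c × P c × pow G c (2 ^ t) ≡ x
    descend zero {x} Hx Px = inj₂ (x , Hx , Px , identityʳ x)
    descend (suc t) {x} Hx Px with descend t Hx Px
    ... | inj₁ full = inj₁ full
    ... | inj₂ (c , Hc , (k , refl) , c^2^t≡x) with any? (λ i → odd? (toℕ (k i)))
    ...   | yes (i , odd) = inj₁ (i , odd-coordinate-projFull H-sub k i Hc odd)
    ...   | no ∄odd with halve Hc (λ i → ¬odd⇒even (∄odd ∘ (i ,_)))
    ...     | c′ , Hc′ , Pc′ , c′∙c′≡c = inj₂ (c′ , Hc′ , Pc′ , (begin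
      pow G c′ (2 * 2 ^ t)              ≡⟨ pow-* G c′ 2 (2 ^ t) ⟩
      pow G (c′ ∙ (c′ ∙ ε)) (2 ^ t)     ≡⟨ cong (λ v → pow G (c′ ∙ v) (2 ^ t)) (identityʳ c′) ⟩
      pow G (c′ ∙ c′) (2 ^ t)           ≡⟨ cong (λ v → pow G v (2 ^ t)) c′∙c′≡c ⟩
      pow G (φ G n m a k) (2 ^ t)       ≡⟨ c^2^t≡x ⟩
      x                                 ∎))

    nontrivial-projFull : ∀ {x} → H x → P x → x ≢ ε → Σ (Fin n) (ProjFull G n m a H)
    nontrivial-projFull Hx Px x≢ε with descend T Hx Px
    ... | inj₁ full                   = full
    ... | inj₂ (c , _ , Pc , c^2^T≡x) = contradiction (trans (sym c^2^T≡x) (P-kill Pc)) x≢ε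

  trivial-or-nontrivial : ∀ {H : Pred (El G) 0ℓ} → Decidable H →
                          TrivialMeetP G n m a H ⊎ Σ (El G) λ x → H x × P x × x ≢ ε
  trivial-or-nontrivial H? with any? (λ x → H? x ×-dec P? x ×-dec ¬? (x ≟ ε))
  ... | yes (x , Hx , Px , x≢ε) = inj₂ (x , Hx , Px , x≢ε)
  ... | no ∄x = inj₁ λ x Hx Px → decidable-stable (x ≟ ε) λ x≢ε → ∄x (x , Hx , Px , x≢ε)

lemma2p6 : (G : FinAbGroup) (n : ℕ) (m : Fin n → ℕ) (a : Fin n → El G) →
    IsSylow2Decomposition G n m a →
    (H : Pred (El G) 0ℓ) → IsSubgroup G H →
    ((IsPerfectCode G H →
        TrivialMeetP G n m a H ⊎ Σ (Fin n) (λ i → ProjFull G n m a H i)) ×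
     (IsTotalPerfectCode G H → Σ (Fin n) (λ i → ProjFull G n m a H i)))
lemma2p6 G n m a D H H-sub = part-a , part-b
  where
  part-a : IsPerfectCode G H → TrivialMeetP G n m a H ⊎ Σ (Fin n) (ProjFull G n m a H)
  part-a (S , S-conn , code) with trivial-or-nontrivial G D (perfectCode-decidable G H-sub S-conn code)
  ... | inj₁ trivial              = inj₁ trivial
  ... | inj₂ (x , Hx , Px , x≢ε) =
    inj₂ (nontrivial-projFull G D H-sub (perfectCode-roots G H-sub S-conn code) Hx Px x≢ε)

  part-b : IsTotalPerfectCode G H → Σ (Fin n) (ProjFull G n m a H)
  part-b (S , S-conn , code) with totalPerfectCode-involution G H-sub S-conn code
  ... | h , Hh , h∙h≡ε , h≢ε =
    nontrivial-projFull G D H-sub (totalPerfectCode-roots G H-sub S-conn code)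
      Hh (involution∈P G D h∙h≡ε) h≢ε
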